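{- Let $k\ge 2$ be an integer and $n=2^k$. Then $t(n)\ge n-2k+1$.
   Context: A cyclic permutation of order $n$ is a bijective labeling of the vertices of a cycle of length $n$ by the elements of $[n]$, up to rotation of the cycle (reflections are not identified). A swap exchanges the labels of any two (not necessarily adjacent) vertices. $t(n)$ is the maximum, over all cyclic permutations of order $n$, of the minimum number of swaps needed to transform it into the trivial cyclic permutation $(1,2,\ldots,n)$ (labels $1,\ldots,n$ consecutively in order around the cycle). Equivalently, with $c=(1,2,\ldots,n)\in S_n$, $C_n=\langle c\rangle$ and $\operatorname{cyc}(\sigma)$ the number of cycles of $\sigma\in S_n$ (fixed points included), $t(n)=\max_{\pi\in S_n}\min_{\sigma\in\pi C_n}(n-\operatorname{cyc}(\sigma))$. -}

module Defs where

open import Data.Nat using (ℕ; zero; suc; _≤_; _<?_; _≤?_)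
open import Data.Fin using (Fin; toℕ; fromℕ<)
open import Data.Fin.Properties using (all?)
open import Data.Fin.Permutation using (Permutation′; _⟨$⟩ʳ_)
open import Data.List using (List; length; filter; allFin)
open import Relation.Nullary using (yes; no; Dec)

iter : ∀ {A : Set} → ℕ → (A → A) → A → A
iter zero    f a = a
iter (suc m) f a = f (iter m f a)

succMod : ∀ {n} → Fin n → Fin n
succMod {suc m} i with suc (toℕ i) <? suc m
... | yes p = fromℕ< p
... | no _  = Fin.zero

-- i is the least element of its cycle under σ (orbits have length ≤ n)
IsCycleMin : ∀ {n} → (Fin n → Fin n) → Fin n → Set
IsCycleMin {n} σ i = ∀ (m : Fin n) → toℕ i ≤ toℕ (iter (toℕ m) σ i)

-- cyc σ : number of cycles of σ (fixed points included),
-- counted via the least element of each cycle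
isCycleMin? : ∀ {n} (σ : Fin n → Fin n) (i : Fin n) → Dec (IsCycleMin σ i)
isCycleMin? σ i = all? (λ m → toℕ i ≤? toℕ (iter (toℕ m) σ i))

cyc : ∀ {n} → (Fin n → Fin n) → ℕ
cyc {n} σ = length (filter (isCycleMin? σ) (allFin n))

-- the element  π ∘ c^j  of the coset  π C_n
cosetElt : ∀ {n} → Permutation′ n → Fin n → Fin n → Fin n
cosetElt π j i = π ⟨$⟩ʳ iter (toℕ j) succMod i

{-# OPTIONS --safe #-}
module Submission where

-- Take π = multiplication by 3 on ℤ/2^k, so that σ = π ∘ c^j is i ↦ 3(i + j).  The
-- injective map φ i = 2i + 3j carries σ to multiplication by 3 on the residues mod
-- 2^(k+1) of the parity of j.  Hence two points whose φ-images lie in one ⟨3⟩-orbit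
-- lie in one cycle of σ (σ^n = id because 3^(2^k) ≡ 1), and cyc σ is at most the
-- number of these orbits.  Lifting from 2^s to 2^(s+1) with 3^(2^(s-2)) ≡ 1 + 2^s
-- (mod 2^(s+1)) shows that the odd residues form the two orbits of 1 and 5, so the
-- even ones form the 2k − 1 orbits of 0, of 2^v (1 ≤ v ≤ k) and of 5·2^v
-- (1 ≤ v ≤ k − 2).  Thus cyc σ ≤ 2k − 1 for every σ in the coset π C_n.

open import Defs
open import Data.Nat using (ℕ; _+_; _*_; _∸_; _^_; _≤_)
open import Data.Fin using (Fin)
open import Data.Fin.Permutation using (Permutation′)
open import Data.Product using (∃-syntax)

open import Data.Nat using (zero; suc; pred; _<_; _<?_; z≤n; s≤s; NonZero; _%_; _/_)
open import Data.Nat.Properties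
open import Data.Nat.DivMod
open import Data.Nat.Divisibility using (_∣_; divides)
open import Data.Nat.Tactic.RingSolver using (solve-∀)
open import Data.Fin using (toℕ; fromℕ<)
open import Data.Fin.Properties using (toℕ-fromℕ<; toℕ-injective; toℕ<n; injective⇒≤)
open import Data.Fin.Permutation using (permutation)
open import Data.List using (List; []; _∷_; _++_; map; length; filter; allFin; lookup)
open import Data.List.Properties using (length-map)
import Data.List.Relation.Unary.All as All
open import Data.List.Relation.Unary.All.Properties using (all-filter)
open import Data.List.Relation.Unary.Any as Any using (Any; here; there)
open import Data.List.Relation.Unary.Any.Properties using (lookup-index; map⁺; ++⁺ˡ; ++⁺ʳ)
open import Data.List.Relation.Unary.AllPairs using (_∷_)
open import Data.List.Relation.Unary.Unique.Propositional using (Unique)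
open import Data.List.Relation.Unary.Unique.Propositional.Properties using (filter⁺; allFin⁺)
open import Data.List.Membership.Propositional.Properties using (∈-lookup)
open import Data.Product using (_,_)
open import Data.Sum using (_⊎_; inj₁; inj₂)
open import Data.Empty using (⊥-elim)
open import Relation.Nullary using (yes; no)
open import Function using (_∘_)
open import Level using (0ℓ)
open import Relation.Binary using (Setoid; IsEquivalence)
import Relation.Binary.Reasoning.Setoid as SetoidReasoning
open import Relation.Binary.PropositionalEquality

-- Iterates and cycle minima

iter-+ : ∀ {A : Set} (f : A → A) a b x → iter (a + b) f x ≡ iter a f (iter b f x)
iter-+ f zero    b x = refl
iter-+ f (suc a) b x = cong f (iter-+ f a b x)

module _ {A : Set} {f : A → A} {p : ℕ} (periodic : ∀ x → iter p f x ≡ x) where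
  open ≡-Reasoning

  iter-*-period : ∀ q x → iter (q * p) f x ≡ x
  iter-*-period zero    x = refl
  iter-*-period (suc q) x = begin
    iter (p + q * p) f x         ≡⟨ iter-+ f p (q * p) x ⟩
    iter p f (iter (q * p) f x)  ≡⟨ periodic _ ⟩
    iter (q * p) f x             ≡⟨ iter-*-period q x ⟩
    x                            ∎

  iter-%-period : .{{_ : NonZero p}} → ∀ d x → iter d f x ≡ iter (d % p) f x
  iter-%-period d x = begin
    iter d f x                             ≡⟨ cong (λ e → iter e f x) (m≡m%n+[m/n]*n d p) ⟩
    iter (d % p + d / p * p) f x           ≡⟨ iter-+ f (d % p) (d / p * p) x ⟩
    iter (d % p) f (iter (d / p * p) f x)  ≡⟨ cong (iter (d % p) f) (iter-*-period (d / p) x) ⟩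
    iter (d % p) f x                       ∎

cycleMin-≤ : ∀ {n} {σ : Fin n → Fin n} → (∀ i → iter n σ i ≡ i) →
             ∀ {i i'} d → IsCycleMin σ i → iter d σ i ≡ i' → toℕ i ≤ toℕ i'
cycleMin-≤ {suc n} {σ} σ^n≡id {i} d min refl = begin
  toℕ i                             ≤⟨ min (fromℕ< r<n) ⟩
  toℕ (iter (toℕ (fromℕ< r<n)) σ i) ≡⟨ cong (λ e → toℕ (iter e σ i)) (toℕ-fromℕ< r<n) ⟩
  toℕ (iter (d % suc n) σ i)        ≡⟨ cong toℕ (iter-%-period σ^n≡id d i) ⟨
  toℕ (iter d σ i)                  ∎
  where
  open ≤-Reasoning
  r<n : d % suc n < suc n
  r<n = m%n<n d (suc n)

cycleMin-unique : ∀ {n} {σ : Fin n → Fin n} → (∀ i → iter n σ i ≡ i) →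
                  ∀ {i i'} d → IsCycleMin σ i → IsCycleMin σ i' → iter d σ i ≡ i' → i ≡ i'
cycleMin-unique {suc n} {σ} σ^n≡id {i} {i'} d min min' i↝i' =
  toℕ-injective (≤-antisym (cycleMin-≤ σ^n≡id d min i↝i') (cycleMin-≤ σ^n≡id (n * d) min' i'↝i))
  where
  open ≡-Reasoning
  i'↝i : iter (n * d) σ i' ≡ i
  i'↝i = begin
    iter (n * d) σ i'             ≡⟨ cong (iter (n * d) σ) i↝i' ⟨
    iter (n * d) σ (iter d σ i)   ≡⟨ iter-+ σ (n * d) d i ⟨
    iter (n * d + d) σ i          ≡⟨ cong (λ e → iter e σ i) (trans (+-comm (n * d) d) (*-comm (suc n) d)) ⟩
    iter (d * suc n) σ i          ≡⟨ iter-*-period σ^n≡id d i ⟩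
    i                             ∎

lookup-injective : ∀ {A : Set} {xs : List A} → Unique xs → ∀ {p q} → lookup xs p ≡ lookup xs q → p ≡ q
lookup-injective (_    ∷ _)  {Fin.zero}  {Fin.zero}  _  = refl
lookup-injective (x∉xs ∷ _)  {Fin.zero}  {Fin.suc q} eq = ⊥-elim (All.lookup x∉xs (∈-lookup q) eq)
lookup-injective (x∉xs ∷ _)  {Fin.suc p} {Fin.zero}  eq = ⊥-elim (All.lookup x∉xs (∈-lookup p) (sym eq))
lookup-injective (_    ∷ xs!) {Fin.suc p} {Fin.suc q} eq = cong Fin.suc (lookup-injective xs! eq)

cyc-≤ : ∀ {n ℓ} {σ : Fin n → Fin n} (key : Fin n → Fin ℓ) →
        (∀ {i i'} → IsCycleMin σ i → IsCycleMin σ i' → key i ≡ key i' → i ≡ i') → cyc σ ≤ ℓ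
cyc-≤ {n} {σ = σ} key key-injective =
  injective⇒≤ λ eq → lookup-injective mins! (key-injective (min _) (min _) eq)
  where
  mins : List (Fin n)
  mins = filter (isCycleMin? σ) (allFin n)
  mins! : Unique mins
  mins! = filter⁺ (isCycleMin? σ) (allFin⁺ n)
  min : ∀ p → IsCycleMin σ (lookup mins p)
  min p = All.lookup (all-filter (isCycleMin? σ) (allFin n)) (∈-lookup p)

-- Congruences

infix 4 _≡_[mod_] _≡_[mod2^_]

record _≡_[mod_] (x y m : ℕ) .{{_ : NonZero m}} : Set where
  constructor mod-≡
  field %-≡ : x % m ≡ y % m

open _≡_[mod_] using (%-≡)

_≡_[mod2^_] : ℕ → ℕ → ℕ → Set
x ≡ y [mod2^ s ] = x ≡ y [mod 2 ^ s ]
  where instance _ = m^n≢0 2 s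

module _ {m : ℕ} .{{_ : NonZero m}} where

  mod-refl : ∀ {x} → x ≡ x [mod m ]
  mod-refl = mod-≡ refl

  mod-sym : ∀ {x y} → x ≡ y [mod m ] → y ≡ x [mod m ]
  mod-sym (mod-≡ eq) = mod-≡ (sym eq)

  mod-trans : ∀ {x y z} → x ≡ y [mod m ] → y ≡ z [mod m ] → x ≡ z [mod m ]
  mod-trans (mod-≡ eq) (mod-≡ eq') = mod-≡ (trans eq eq')

  mod-isEquivalence : IsEquivalence (_≡_[mod m ])
  mod-isEquivalence = record { refl = mod-refl ; sym = mod-sym ; trans = mod-trans }

mod-setoid : (m : ℕ) .{{_ : NonZero m}} → Setoid 0ℓ 0ℓ
mod-setoid m = record { isEquivalence = mod-isEquivalence {m} }

module mod-Reasoning (m : ℕ) .{{_ : NonZero m}} = SetoidReasoning (mod-setoid m)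

module _ {m : ℕ} .{{_ : NonZero m}} where

  mod-% : ∀ x → x % m ≡ x [mod m ]
  mod-% x = mod-≡ (m%n%n≡m%n x m)

  mod-+-multiple : ∀ x k → x + k * m ≡ x [mod m ]
  mod-+-multiple x k = mod-≡ ([m+kn]%n≡m%n x k m)

  mod-+-modulus : ∀ x → x + m ≡ x [mod m ]
  mod-+-modulus x = mod-≡ ([m+n]%n≡m%n x m)

  mod-+-cong : ∀ {x y u v} → x ≡ y [mod m ] → u ≡ v [mod m ] → x + u ≡ y + v [mod m ]
  mod-+-cong {x} {y} {u} {v} (mod-≡ eq) (mod-≡ eq') = mod-≡ (begin
    (x + u) % m             ≡⟨ %-distribˡ-+ x u m ⟩
    (x % m + u % m) % m     ≡⟨ cong₂ (λ a b → (a + b) % m) eq eq' ⟩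
    (y % m + v % m) % m     ≡⟨ %-distribˡ-+ y v m ⟨
    (y + v) % m             ∎)
    where open ≡-Reasoning

  mod-*-cong : ∀ {x y u v} → x ≡ y [mod m ] → u ≡ v [mod m ] → x * u ≡ y * v [mod m ]
  mod-*-cong {x} {y} {u} {v} (mod-≡ eq) (mod-≡ eq') = mod-≡ (begin
    (x * u) % m             ≡⟨ %-distribˡ-* x u m ⟩
    (x % m * (u % m)) % m   ≡⟨ cong₂ (λ a b → (a * b) % m) eq eq' ⟩
    (y % m * (v % m)) % m   ≡⟨ %-distribˡ-* y v m ⟨
    (y * v) % m             ∎)
    where open ≡-Reasoning

  mod-*-congˡ : ∀ z {x y} → x ≡ y [mod m ] → z * x ≡ z * y [mod m ]
  mod-*-congˡ z = mod-*-cong (mod-refl {x = z})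

  mod-*-congʳ : ∀ z {x y} → x ≡ y [mod m ] → x * z ≡ y * z [mod m ]
  mod-*-congʳ z x≡y = mod-*-cong x≡y (mod-refl {x = z})

  mod-+-cancelʳ : ∀ {x y} z → x + z ≡ y + z [mod m ] → x ≡ y [mod m ]
  mod-+-cancelʳ {x} {y} z x+z≡y+z = begin
    x                    ≈⟨ cancels x ⟨
    x + z + (m ∸ z % m)  ≈⟨ mod-+-cong x+z≡y+z mod-refl ⟩
    y + z + (m ∸ z % m)  ≈⟨ cancels y ⟩
    y                    ∎
    where
    open mod-Reasoning m
    cancels : ∀ w → w + z + (m ∸ z % m) ≡ w [mod m ]
    cancels w = begin
      w + z + (m ∸ z % m)       ≡⟨ +-assoc w z _ ⟩
      w + (z + (m ∸ z % m))     ≈⟨ mod-+-cong (mod-refl {x = w}) (mod-+-cong (mod-sym (mod-% z)) mod-refl) ⟩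
      w + (z % m + (m ∸ z % m)) ≡⟨ cong (w +_) (m+[n∸m]≡n (<⇒≤ (m%n<n z m))) ⟩
      w + m                     ≈⟨ mod-+-modulus w ⟩
      w                         ∎

  mod-<⇒≡ : ∀ {x y} → x < m → y < m → x ≡ y [mod m ] → x ≡ y
  mod-<⇒≡ {x} {y} x<m y<m (mod-≡ eq) = begin
    x      ≡⟨ m<n⇒m%n≡m x<m ⟨
    x % m  ≡⟨ eq ⟩
    y % m  ≡⟨ m<n⇒m%n≡m y<m ⟩
    y      ∎
    where open ≡-Reasoning

mod-∣-weaken : ∀ {d m} .{{_ : NonZero d}} .{{_ : NonZero m}} {x y} →
               d ∣ m → x ≡ y [mod m ] → x ≡ y [mod d ]
mod-∣-weaken {d} {m} {x = x} {y} d∣m (mod-≡ eq) = mod-≡ (begin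
  x % d      ≡⟨ m∣n⇒o%n%m≡o%m d m x d∣m ⟨
  x % m % d  ≡⟨ cong (_% d) eq ⟩
  y % m % d  ≡⟨ m∣n⇒o%n%m≡o%m d m y d∣m ⟩
  y % d      ∎)
  where open ≡-Reasoning

mod2^-weaken : ∀ e s {x y} → x ≡ y [mod2^ e + s ] → x ≡ y [mod2^ s ]
mod2^-weaken e s = mod-∣-weaken (divides (2 ^ e) (^-distribˡ-+-* 2 e s))
  where instance _ = m^n≢0 2 s
                 _ = m^n≢0 2 (e + s)

module _ {m : ℕ} .{{_ : NonZero m}} .{{_ : NonZero (2 * m)}} where

  [2*x]%[2*m]≡2*[x%m] : ∀ x → (2 * x) % (2 * m) ≡ 2 * (x % m)
  [2*x]%[2*m]≡2*[x%m] x = begin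
    (2 * x) % (2 * m)                          ≡⟨ cong (λ y → (2 * y) % (2 * m)) (m≡m%n+[m/n]*n x m) ⟩
    (2 * (x % m + x / m * m)) % (2 * m)        ≡⟨ cong (_% (2 * m)) (shape (x % m) (x / m) m) ⟩
    (2 * (x % m) + x / m * (2 * m)) % (2 * m)  ≡⟨ [m+kn]%n≡m%n (2 * (x % m)) (x / m) (2 * m) ⟩
    (2 * (x % m)) % (2 * m)                    ≡⟨ m<n⇒m%n≡m (*-monoʳ-< 2 (m%n<n x m)) ⟩
    2 * (x % m)                                ∎
    where
    open ≡-Reasoning
    shape : ∀ r q m → 2 * (r + q * m) ≡ 2 * r + q * (2 * m)
    shape = solve-∀

  mod-double : ∀ {x y} → x ≡ y [mod m ] → 2 * x ≡ 2 * y [mod 2 * m ]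
  mod-double {x} {y} (mod-≡ eq) = mod-≡ (trans ([2*x]%[2*m]≡2*[x%m] x) (trans (cong (2 *_) eq) (sym ([2*x]%[2*m]≡2*[x%m] y))))

  mod-halve : ∀ {x y} → 2 * x ≡ 2 * y [mod 2 * m ] → x ≡ y [mod m ]
  mod-halve {x} {y} (mod-≡ eq) = mod-≡ (*-cancelˡ-≡ (x % m) (y % m) 2 (trans (sym ([2*x]%[2*m]≡2*[x%m] x)) (trans eq ([2*x]%[2*m]≡2*[x%m] y))))

  bit-expansion : ∀ x → x ≡ x % m + x / m % 2 * m [mod 2 * m ]
  bit-expansion x = begin
    x                                             ≡⟨ m≡m%n+[m/n]*n x m ⟩
    x % m + x / m * m                             ≡⟨ cong (λ q → x % m + q * m) (m≡m%n+[m/n]*n (x / m) 2) ⟩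
    x % m + (x / m % 2 + x / m / 2 * 2) * m       ≡⟨ shape (x % m) (x / m % 2) (x / m / 2) m ⟩
    x % m + x / m % 2 * m + x / m / 2 * (2 * m)   ≈⟨ mod-+-multiple _ (x / m / 2) ⟩
    x % m + x / m % 2 * m                         ∎
    where
    open mod-Reasoning (2 * m)
    shape : ∀ r b q m → r + (b + q * 2) * m ≡ r + b * m + q * (2 * m)
    shape = solve-∀

  mod-split : ∀ x → x ≡ x % m [mod 2 * m ] ⊎ x ≡ x % m + m [mod 2 * m ]
  mod-split x with x / m % 2 in bit | m%n<n (x / m) 2
  ... | 0 | _ = inj₁ (begin
    x                      ≈⟨ bit-expansion x ⟩
    x % m + x / m % 2 * m  ≡⟨ cong (λ b → x % m + b * m) bit ⟩
    x % m + 0              ≡⟨ +-identityʳ (x % m) ⟩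
    x % m                  ∎)
    where open mod-Reasoning (2 * m)
  ... | 1 | _ = inj₂ (begin
    x                      ≈⟨ bit-expansion x ⟩
    x % m + x / m % 2 * m  ≡⟨ cong (λ b → x % m + b * m) bit ⟩
    x % m + (m + 0)        ≡⟨ cong (x % m +_) (+-identityʳ m) ⟩
    x % m + m              ∎)
    where open mod-Reasoning (2 * m)
  ... | suc (suc _) | s≤s (s≤s ())

  mod-lift : ∀ {x y} → x ≡ y [mod m ] → x ≡ y [mod 2 * m ] ⊎ x ≡ y + m [mod 2 * m ]
  mod-lift {x} {y} (mod-≡ eq) with mod-split x | mod-split y
  ... | inj₁ x≡ | inj₁ y≡ = inj₁ (begin
    x      ≈⟨ x≡ ⟩
    x % m  ≡⟨ eq ⟩
    y % m  ≈⟨ y≡ ⟨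
    y      ∎)
    where open mod-Reasoning (2 * m)
  ... | inj₂ x≡ | inj₂ y≡ = inj₁ (begin
    x          ≈⟨ x≡ ⟩
    x % m + m  ≡⟨ cong (_+ m) eq ⟩
    y % m + m  ≈⟨ y≡ ⟨
    y          ∎)
    where open mod-Reasoning (2 * m)
  ... | inj₂ x≡ | inj₁ y≡ = inj₂ (begin
    x          ≈⟨ x≡ ⟩
    x % m + m  ≡⟨ cong (_+ m) eq ⟩
    y % m + m  ≈⟨ mod-+-cong y≡ mod-refl ⟨
    y + m      ∎)
    where open mod-Reasoning (2 * m)
  ... | inj₁ x≡ | inj₂ y≡ = inj₂ (begin
    x                  ≈⟨ x≡ ⟩
    x % m              ≡⟨ eq ⟩
    y % m              ≈⟨ mod-+-modulus (y % m) ⟨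
    y % m + 2 * m      ≡⟨ shape (y % m) m ⟩
    y % m + m + m      ≈⟨ mod-+-cong y≡ mod-refl ⟨
    y + m              ∎)
    where
    open mod-Reasoning (2 * m)
    shape : ∀ r m → r + 2 * m ≡ r + m + m
    shape = solve-∀

parity : ∀ w → w ≡ 0 [mod 2 ] ⊎ w ≡ 1 [mod 2 ]
parity w with w % 2 in r | m%n<n w 2
... | 0 | _ = inj₁ (mod-≡ r)
... | 1 | _ = inj₂ (mod-≡ r)
... | suc (suc _) | s≤s (s≤s ())

even-half : ∀ {w} → w ≡ 0 [mod 2 ] → 2 * (w / 2) ≡ w
even-half {w} (mod-≡ w%2≡0) = begin
  2 * (w / 2)        ≡⟨ *-comm 2 (w / 2) ⟩
  w / 2 * 2          ≡⟨ cong (_+ w / 2 * 2) w%2≡0 ⟨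
  w % 2 + w / 2 * 2  ≡⟨ m≡m%n+[m/n]*n w 2 ⟨
  w                  ∎
  where open ≡-Reasoning

odd-half : ∀ {u} → u ≡ 1 [mod 2 ] → 1 + 2 * (u / 2) ≡ u
odd-half {u} (mod-≡ u%2≡1) = begin
  1 + 2 * (u / 2)    ≡⟨ cong (1 +_) (*-comm 2 (u / 2)) ⟩
  1 + u / 2 * 2      ≡⟨ cong (_+ u / 2 * 2) u%2≡1 ⟨
  u % 2 + u / 2 * 2  ≡⟨ m≡m%n+[m/n]*n u 2 ⟨
  u                  ∎
  where open ≡-Reasoning

-- Counting cycles through a semiconjugacy to a multiplication map

module Semiconjugacy {n m : ℕ} .{{_ : NonZero m}} (σ : Fin n → Fin n) (g : ℕ) (φ : Fin n → ℕ)
  (φ-injective : ∀ {i i'} → φ i ≡ φ i' [mod m ] → i ≡ i')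
  (φ-σ : ∀ i → φ (σ i) ≡ g * φ i [mod m ])
  where

  φ-iter : ∀ d i → φ (iter d σ i) ≡ g ^ d * φ i [mod m ]
  φ-iter zero    i = mod-≡ (cong (_% m) (sym (*-identityˡ (φ i))))
  φ-iter (suc d) i = begin
    φ (σ (iter d σ i))   ≈⟨ φ-σ (iter d σ i) ⟩
    g * φ (iter d σ i)   ≈⟨ mod-*-congˡ g (φ-iter d i) ⟩
    g * (g ^ d * φ i)    ≡⟨ *-assoc g (g ^ d) (φ i) ⟨
    g ^ suc d * φ i      ∎
    where open mod-Reasoning m

  σ^n≡id : g ^ n ≡ 1 [mod m ] → ∀ i → iter n σ i ≡ i
  σ^n≡id g^n≡1 i = φ-injective (begin
    φ (iter n σ i)  ≈⟨ φ-iter n i ⟩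
    g ^ n * φ i     ≈⟨ mod-*-congʳ (φ i) g^n≡1 ⟩
    1 * φ i         ≡⟨ *-identityˡ (φ i) ⟩
    φ i             ∎)
    where open mod-Reasoning m

  orbit-reachable : ∀ {r i i' a a'} → g ^ a * r ≡ φ i [mod m ] → g ^ a' * r ≡ φ i' [mod m ] →
                    a ≤ a' → iter (a' ∸ a) σ i ≡ i'
  orbit-reachable {r} {i} {i'} {a} {a'} i∈r i'∈r a≤a' = φ-injective (begin
    φ (iter (a' ∸ a) σ i)       ≈⟨ φ-iter (a' ∸ a) i ⟩
    g ^ (a' ∸ a) * φ i          ≈⟨ mod-*-congˡ (g ^ (a' ∸ a)) i∈r ⟨
    g ^ (a' ∸ a) * (g ^ a * r)  ≡⟨ *-assoc (g ^ (a' ∸ a)) (g ^ a) r ⟨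
    g ^ (a' ∸ a) * g ^ a * r    ≡⟨ cong (_* r) (^-distribˡ-+-* g (a' ∸ a) a) ⟨
    g ^ (a' ∸ a + a) * r        ≡⟨ cong (λ e → g ^ e * r) (m∸n+n≡m a≤a') ⟩
    g ^ a' * r                  ≈⟨ i'∈r ⟩
    φ i'                        ∎)
    where open mod-Reasoning m

  cyc-≤-#orbits : g ^ n ≡ 1 [mod m ] → (reps : List ℕ) →
                  (∀ i → Any (λ r → ∃[ a ] g ^ a * r ≡ φ i [mod m ]) reps) →
                  cyc σ ≤ length reps
  cyc-≤-#orbits g^n≡1 reps cover = cyc-≤ (Any.index ∘ cover) same-orbit
    where
    same-orbit : ∀ {i i'} → IsCycleMin σ i → IsCycleMin σ i' →
                 Any.index (cover i) ≡ Any.index (cover i') → i ≡ i'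
    same-orbit {i} {i'} min min' eq
      with lookup-index (cover i)
         | subst (λ q → ∃[ a ] g ^ a * lookup reps q ≡ φ i' [mod m ]) (sym eq) (lookup-index (cover i'))
    ... | a , i∈r | a' , i'∈r with ≤-total a a'
    ... | inj₁ a≤a' = cycleMin-unique (σ^n≡id g^n≡1) (a' ∸ a) min min' (orbit-reachable i∈r i'∈r a≤a')
    ... | inj₂ a'≤a = sym (cycleMin-unique (σ^n≡id g^n≡1) (a ∸ a') min' min (orbit-reachable i'∈r i∈r a'≤a))

-- Orbits of multiplication by 3 on ℤ/2^s

3^2^[1+t] : ∀ t → ∃[ c ] 3 ^ 2 ^ suc t ≡ 1 + 2 ^ (3 + t) + c * 2 ^ (4 + t)
3^2^[1+t] zero    = 0 , refl
3^2^[1+t] (suc t) with 3^2^[1+t] t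
... | c , eq = c + 2 * 2 ^ t * ((1 + 2 * c) * (1 + 2 * c)) , (begin
  3 ^ (2 ^ suc t + (2 ^ suc t + 0))           ≡⟨ cong (λ e → 3 ^ (2 ^ suc t + e)) (+-identityʳ (2 ^ suc t)) ⟩
  3 ^ (2 ^ suc t + 2 ^ suc t)                 ≡⟨ ^-distribˡ-+-* 3 (2 ^ suc t) (2 ^ suc t) ⟩
  3 ^ 2 ^ suc t * 3 ^ 2 ^ suc t               ≡⟨ cong (λ x → x * x) eq ⟩
  (1 + 2 ^ (3 + t) + c * 2 ^ (4 + t)) * (1 + 2 ^ (3 + t) + c * 2 ^ (4 + t))
                                              ≡⟨ square (2 ^ t) c ⟩
  1 + 2 ^ (4 + t) + (c + 2 * 2 ^ t * ((1 + 2 * c) * (1 + 2 * c))) * 2 ^ (5 + t) ∎)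
  where
  open ≡-Reasoning
  square : ∀ y c → let Y = 2 * (2 * (2 * y)) in
           (1 + Y + c * (2 * Y)) * (1 + Y + c * (2 * Y)) ≡ 1 + 2 * Y + (c + 2 * y * ((1 + 2 * c) * (1 + 2 * c))) * (2 * (2 * Y))
  square = solve-∀

3^2^[1+t]≡1+2^[3+t] : ∀ t → 3 ^ 2 ^ suc t ≡ 1 + 2 ^ (3 + t) [mod2^ (4 + t) ]
3^2^[1+t]≡1+2^[3+t] t with 3^2^[1+t] t
... | c , eq = begin
  3 ^ 2 ^ suc t                        ≡⟨ eq ⟩
  1 + 2 ^ (3 + t) + c * 2 ^ (4 + t)    ≈⟨ mod-+-multiple _ c ⟩
  1 + 2 ^ (3 + t)                      ∎
  where instance _ = m^n≢0 2 (4 + t)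
        open mod-Reasoning (2 ^ (4 + t))

3^2^[1+t]≡1 : ∀ t → 3 ^ 2 ^ suc t ≡ 1 [mod2^ (3 + t) ]
3^2^[1+t]≡1 t = mod-trans (mod2^-weaken 1 (3 + t) (3^2^[1+t]≡1+2^[3+t] t)) (mod-+-modulus 1)
  where instance _ = m^n≢0 2 (3 + t)

odd-shift : ∀ s {u} → u ≡ 1 [mod 2 ] → (1 + 2 ^ suc s) * (u + 2 ^ suc s) ≡ u [mod2^ (2 + s) ]
odd-shift s {u} u-odd = begin
  (1 + 2 ^ suc s) * (u + 2 ^ suc s)                  ≡⟨ cong (λ v → (1 + 2 ^ suc s) * (v + 2 ^ suc s)) (odd-half u-odd) ⟨
  (1 + 2 ^ suc s) * (1 + 2 * (u / 2) + 2 ^ suc s)    ≡⟨ shape (u / 2) (2 ^ s) ⟩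
  1 + 2 * (u / 2) + (1 + u / 2 + 2 ^ s) * 2 ^ (2 + s) ≈⟨ mod-+-multiple _ (1 + u / 2 + 2 ^ s) ⟩
  1 + 2 * (u / 2)                                    ≡⟨ odd-half u-odd ⟩
  u                                                  ∎
  where
  instance _ = m^n≢0 2 (2 + s)
  open mod-Reasoning (2 ^ (2 + s))
  shape : ∀ w y → (1 + 2 * y) * (1 + 2 * w + 2 * y) ≡ 1 + 2 * w + (1 + w + y) * (2 * (2 * y))
  shape = solve-∀

-- If 3^a r misses the odd u by 2^(3+t) modulo 2^(4+t), multiplying by
-- 3^(2^(1+t)) ≡ 1 + 2^(3+t) repairs it.
lift-orbit : ∀ t {u r} → u ≡ 1 [mod 2 ] →
             ∃[ a ] 3 ^ a * r ≡ u [mod2^ (3 + t) ] → ∃[ a ] 3 ^ a * r ≡ u [mod2^ (4 + t) ]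
lift-orbit t {u} {r} u-odd (a , 3^ar≡u) = lifted (mod-lift 3^ar≡u)
  where
  instance _ = m^n≢0 2 (3 + t)
           _ = m^n≢0 2 (4 + t)
  open mod-Reasoning (2 ^ (4 + t))
  lifted : 3 ^ a * r ≡ u [mod2^ (4 + t) ] ⊎ 3 ^ a * r ≡ u + 2 ^ (3 + t) [mod2^ (4 + t) ] →
           ∃[ a ] 3 ^ a * r ≡ u [mod2^ (4 + t) ]
  lifted (inj₁ 3^ar≡u′) = a , 3^ar≡u′
  lifted (inj₂ 3^ar≡u+2^[3+t]) = 2 ^ suc t + a , (begin
    3 ^ (2 ^ suc t + a) * r                   ≡⟨ cong (_* r) (^-distribˡ-+-* 3 (2 ^ suc t) a) ⟩
    3 ^ 2 ^ suc t * 3 ^ a * r                 ≡⟨ *-assoc (3 ^ 2 ^ suc t) (3 ^ a) r ⟩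
    3 ^ 2 ^ suc t * (3 ^ a * r)               ≈⟨ mod-*-cong (3^2^[1+t]≡1+2^[3+t] t) 3^ar≡u+2^[3+t] ⟩
    (1 + 2 ^ (3 + t)) * (u + 2 ^ (3 + t))     ≈⟨ odd-shift (2 + t) u-odd ⟩
    u                                         ∎)

oddOrbitReps : ℕ → List ℕ
oddOrbitReps (suc (suc (suc _))) = 1 ∷ 5 ∷ []
oddOrbitReps _                   = 1 ∷ []

oddOrbitReps-cover : ∀ s {u} → u ≡ 1 [mod 2 ] →
                     Any (λ r → ∃[ a ] 3 ^ a * r ≡ u [mod2^ s ]) (oddOrbitReps s)
oddOrbitReps-cover 0 {u} _ = here (0 , mod-≡ (trans (n%1≡0 1) (sym (n%1≡0 u))))
oddOrbitReps-cover 1 u≡1 = here (0 , mod-sym u≡1)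
oddOrbitReps-cover 2 u≡1 with mod-lift u≡1
... | inj₁ u≡1′ = here (0 , mod-sym u≡1′)
... | inj₂ u≡3  = here (1 , mod-sym u≡3)
oddOrbitReps-cover 3 u≡1 with mod-lift u≡1
... | inj₁ u≡1′ with mod-lift u≡1′
...   | inj₁ u≡1″ = here (0 , mod-sym u≡1″)
...   | inj₂ u≡5  = there (here (0 , mod-sym u≡5))
oddOrbitReps-cover 3 u≡1 | inj₂ u≡3 with mod-lift u≡3
...   | inj₁ u≡3′ = here (1 , mod-sym u≡3′)
...   | inj₂ u≡7  = there (here (1 , mod-trans (mod-≡ refl) (mod-sym u≡7)))
oddOrbitReps-cover (suc (suc (suc (suc t)))) u-odd =
  Any.map (lift-orbit t u-odd) (oddOrbitReps-cover (suc (suc (suc t))) u-odd)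

orbitReps : ℕ → List ℕ
orbitReps zero    = 0 ∷ []
orbitReps (suc s) = oddOrbitReps (suc s) ++ map (2 *_) (orbitReps s)

orbitReps-cover : ∀ s w → Any (λ r → ∃[ a ] 3 ^ a * r ≡ w [mod2^ s ]) (orbitReps s)
evenOrbitReps-cover : ∀ s {w} → w ≡ 0 [mod 2 ] →
                      Any (λ r → ∃[ a ] 3 ^ a * r ≡ w [mod2^ suc s ]) (map (2 *_) (orbitReps s))

orbitReps-cover zero    w = here (0 , mod-≡ (trans (n%1≡0 0) (sym (n%1≡0 w))))
orbitReps-cover (suc s) w with parity w
... | inj₁ w-even = ++⁺ʳ (oddOrbitReps (suc s)) (evenOrbitReps-cover s w-even)
... | inj₂ w-odd  = ++⁺ˡ (oddOrbitReps-cover (suc s) w-odd)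

evenOrbitReps-cover s {w} w-even = map⁺ (Any.map doubled (orbitReps-cover s (w / 2)))
  where
  instance _ = m^n≢0 2 s
           _ = m^n≢0 2 (suc s)
  doubled : ∀ {r} → ∃[ a ] 3 ^ a * r ≡ w / 2 [mod2^ s ] → ∃[ a ] 3 ^ a * (2 * r) ≡ w [mod2^ suc s ]
  doubled {r} (a , 3^ar≡w/2) = a , (begin
    3 ^ a * (2 * r)   ≡⟨ swap (3 ^ a) r ⟩
    2 * (3 ^ a * r)   ≈⟨ mod-double 3^ar≡w/2 ⟩
    2 * (w / 2)       ≡⟨ even-half w-even ⟩
    w                 ∎)
    where
    open mod-Reasoning (2 ^ suc s)
    swap : ∀ p r → p * (2 * r) ≡ 2 * (p * r)
    swap = solve-∀

length-orbitReps : ∀ t → length (orbitReps (2 + t)) ≡ 3 + 2 * t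
length-orbitReps zero    = refl
length-orbitReps (suc t) = begin
  2 + length (map (2 *_) (orbitReps (2 + t)))  ≡⟨ cong (2 +_) (length-map (2 *_) (orbitReps (2 + t))) ⟩
  2 + length (orbitReps (2 + t))               ≡⟨ cong (2 +_) (length-orbitReps t) ⟩
  3 + (2 + 2 * t)                              ≡⟨ cong (3 +_) (*-suc 2 t) ⟨
  3 + 2 * suc t                                ∎
  where open ≡-Reasoning

-- The permutation i ↦ 3i and its coset

toℕ-succMod : ∀ {n} .{{_ : NonZero n}} (i : Fin n) → toℕ (succMod i) ≡ suc (toℕ i) % n
toℕ-succMod {suc n} i with suc (toℕ i) <? suc n
... | yes i+1<n = trans (toℕ-fromℕ< i+1<n) (sym (m<n⇒m%n≡m i+1<n))
... | no  i+1≮n = sym (trans (cong (_% suc n) (≤-antisym (toℕ<n i) (≮⇒≥ i+1≮n))) (n%n≡0 (suc n)))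

toℕ-iter-succMod : ∀ {n} .{{_ : NonZero n}} d (i : Fin n) → toℕ (iter d succMod i) ≡ (toℕ i + d) % n
toℕ-iter-succMod {n} zero    i = sym (trans (cong (_% n) (+-identityʳ (toℕ i))) (m<n⇒m%n≡m (toℕ<n i)))
toℕ-iter-succMod {n} (suc d) i = begin
  toℕ (succMod (iter d succMod i))  ≡⟨ toℕ-succMod (iter d succMod i) ⟩
  suc (toℕ (iter d succMod i)) % n  ≡⟨ cong (λ x → suc x % n) (toℕ-iter-succMod d i) ⟩
  suc ((toℕ i + d) % n) % n         ≡⟨ %-≡ (mod-+-cong (mod-refl {x = 1}) (mod-% (toℕ i + d))) ⟩
  suc (toℕ i + d) % n               ≡⟨ cong (_% n) (+-suc (toℕ i) d) ⟨
  (toℕ i + suc d) % n               ∎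
  where open ≡-Reasoning

module _ {n : ℕ} .{{_ : NonZero n}} where

  mulMod : ℕ → Fin n → Fin n
  mulMod a i = fromℕ< (m%n<n (a * toℕ i) n)

  toℕ-mulMod : ∀ a i → toℕ (mulMod a i) ≡ (a * toℕ i) % n
  toℕ-mulMod a i = toℕ-fromℕ< (m%n<n (a * toℕ i) n)

  mulMod-inverse : ∀ a b → a * b ≡ 1 [mod n ] → ∀ i → mulMod a (mulMod b i) ≡ i
  mulMod-inverse a b ab≡1 i = toℕ-injective (mod-<⇒≡ (toℕ<n (mulMod a (mulMod b i))) (toℕ<n i) (begin
    toℕ (mulMod a (mulMod b i))  ≡⟨ toℕ-mulMod a (mulMod b i) ⟩
    (a * toℕ (mulMod b i)) % n   ≈⟨ mod-% _ ⟩
    a * toℕ (mulMod b i)         ≡⟨ cong (a *_) (toℕ-mulMod b i) ⟩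
    a * ((b * toℕ i) % n)        ≈⟨ mod-*-congˡ a (mod-% (b * toℕ i)) ⟩
    a * (b * toℕ i)              ≡⟨ *-assoc a b (toℕ i) ⟨
    a * b * toℕ i                ≈⟨ mod-*-congʳ (toℕ i) ab≡1 ⟩
    1 * toℕ i                    ≡⟨ *-identityˡ (toℕ i) ⟩
    toℕ i                        ∎))
    where open mod-Reasoning n

  mulPermutation : ∀ a b → a * b ≡ 1 [mod n ] → Permutation′ n
  mulPermutation a b ab≡1 = permutation (mulMod a) (mulMod b) (mulMod-inverse a b ab≡1)
    (mulMod-inverse b a (subst (_≡ 1 [mod n ]) (*-comm a b) ab≡1))

module Times3 (t : ℕ) where

  k : ℕ
  k = 2 + t

  N : ℕ
  N = 2 ^ k

  instance
    N≢0 : NonZero N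
    N≢0 = m^n≢0 2 k
    2N≢0 : NonZero (2 * N)
    2N≢0 = m^n≢0 2 (suc k)

  3^N≡1 : 3 ^ N ≡ 1 [mod 2 * N ]
  3^N≡1 = mod2^-weaken 1 (suc k) (3^2^[1+t]≡1 (suc t))

  times3 : Permutation′ N
  times3 = mulPermutation 3 (3 ^ pred N) (begin
    3 * 3 ^ pred N  ≡⟨ cong (3 ^_) (suc-pred N) ⟩
    3 ^ N           ≈⟨ mod2^-weaken 1 k 3^N≡1 ⟩
    1               ∎)
    where open mod-Reasoning N

  module _ (j : Fin N) where

    jₙ : ℕ
    jₙ = toℕ j

    σ : Fin N → Fin N
    σ = cosetElt times3 j

    -- The shift by 3j/2 conjugating σ i = 3(i + j) to i ↦ 3i, doubled so that it also
    -- exists for odd j:  2·3(i + j) + 3j = 3(2i + 3j).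
    φ : Fin N → ℕ
    φ i = 2 * toℕ i + 3 * jₙ

    φ-injective : ∀ {i i'} → φ i ≡ φ i' [mod 2 * N ] → i ≡ i'
    φ-injective {i} {i'} φi≡φi' =
      toℕ-injective (mod-<⇒≡ (toℕ<n i) (toℕ<n i') (mod-halve (mod-+-cancelʳ (3 * jₙ) φi≡φi')))

    φ-σ : ∀ i → φ (σ i) ≡ 3 * φ i [mod 2 * N ]
    φ-σ i = begin
      2 * toℕ (σ i) + 3 * jₙ                   ≡⟨ cong (λ y → 2 * y + 3 * jₙ) toℕ-σ ⟩
      2 * ((3 * ((x + jₙ) % N)) % N) + 3 * jₙ  ≈⟨ mod-+-cong (mod-double (mod-% (3 * ((x + jₙ) % N)))) mod-refl ⟩
      2 * (3 * ((x + jₙ) % N)) + 3 * jₙ        ≡⟨ cong (_+ 3 * jₙ) (swap ((x + jₙ) % N)) ⟩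
      3 * (2 * ((x + jₙ) % N)) + 3 * jₙ        ≈⟨ mod-+-cong (mod-*-congˡ 3 (mod-double (mod-% (x + jₙ)))) mod-refl ⟩
      3 * (2 * (x + jₙ)) + 3 * jₙ              ≡⟨ distrib x jₙ ⟩
      3 * (2 * x + 3 * jₙ)                     ∎
      where
      open mod-Reasoning (2 * N)
      x : ℕ
      x = toℕ i
      toℕ-σ : toℕ (σ i) ≡ (3 * ((x + jₙ) % N)) % N
      toℕ-σ = trans (toℕ-mulMod 3 (iter jₙ succMod i)) (cong (λ y → (3 * y) % N) (toℕ-iter-succMod jₙ i))
      swap : ∀ y → 2 * (3 * y) ≡ 3 * (2 * y)
      swap = solve-∀
      distrib : ∀ x jₙ → 3 * (2 * (x + jₙ)) + 3 * jₙ ≡ 3 * (2 * x + 3 * jₙ)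
      distrib = solve-∀

    φ-parity : ∀ i → φ i ≡ jₙ [mod 2 ]
    φ-parity i = mod-trans (mod-≡ (cong (_% 2) (shape (toℕ i) jₙ))) (mod-+-multiple jₙ (toℕ i + jₙ))
      where
      shape : ∀ x jₙ → 2 * x + 3 * jₙ ≡ jₙ + (x + jₙ) * 2
      shape = solve-∀

    open Semiconjugacy σ 3 φ φ-injective φ-σ

    cyc-σ-≤ : cyc σ ≤ 3 + 2 * t
    cyc-σ-≤ with parity jₙ
    ... | inj₁ jₙ-even = begin
      cyc σ                              ≤⟨ cyc-≤-#orbits 3^N≡1 (map (2 *_) (orbitReps k)) cover ⟩
      length (map (2 *_) (orbitReps k))  ≡⟨ length-map (2 *_) (orbitReps k) ⟩
      length (orbitReps k)               ≡⟨ length-orbitReps t ⟩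
      3 + 2 * t                          ∎
      where
      open ≤-Reasoning
      cover : ∀ i → Any (λ r → ∃[ a ] 3 ^ a * r ≡ φ i [mod2^ suc k ]) (map (2 *_) (orbitReps k))
      cover i = evenOrbitReps-cover k (mod-trans (φ-parity i) jₙ-even)
    ... | inj₂ jₙ-odd = begin
      cyc σ      ≤⟨ cyc-≤-#orbits 3^N≡1 (oddOrbitReps (suc k)) cover ⟩
      2          ≤⟨ m≤m+n 2 (1 + 2 * t) ⟩
      3 + 2 * t  ∎
      where
      open ≤-Reasoning
      cover : ∀ i → Any (λ r → ∃[ a ] 3 ^ a * r ≡ φ i [mod2^ suc k ]) (oddOrbitReps (suc k))
      cover i = oddOrbitReps-cover (suc k) (mod-trans (φ-parity i) jₙ-odd)

    cyc-σ-< : cyc σ < 2 * k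
    cyc-σ-< = subst (cyc σ <_) (sym (*-distribˡ-+ 2 2 t)) (s≤s cyc-σ-≤)

2*n≤2^n : ∀ n → 2 * n ≤ 2 ^ n
2*n≤2^n zero          = z≤n
2*n≤2^n (suc zero)    = ≤-refl
2*n≤2^n (suc (suc n)) = begin
  2 * suc (suc n)          ≡⟨ *-suc 2 (suc n) ⟩
  2 + 2 * suc n            ≤⟨ +-mono-≤ (^-monoʳ-≤ 2 (s≤s (z≤n {n}))) (2*n≤2^n (suc n)) ⟩
  2 ^ suc n + 2 ^ suc n    ≡⟨ cong (2 ^ suc n +_) (+-identityʳ (2 ^ suc n)) ⟨
  2 ^ suc (suc n)          ∎
  where open ≤-Reasoning

m∸n+1≤m∸o : ∀ {m n o} → o < n → n ≤ m → m ∸ n + 1 ≤ m ∸ o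
m∸n+1≤m∸o {m} {n} {o} o<n n≤m = subst (_≤ m ∸ o) (+-comm 1 (m ∸ n)) (∸-monoʳ-< o<n n≤m)

proposition3p8 : (k : ℕ) → 2 ≤ k →
    ∃[ π ] ((j : Fin (2 ^ k)) →
      2 ^ k ∸ 2 * k + 1 ≤ 2 ^ k ∸ cyc (cosetElt {2 ^ k} π j))
proposition3p8 (suc (suc t)) _ = times3 , λ j → m∸n+1≤m∸o (cyc-σ-< j) (2*n≤2^n k)
  where open Times3 t
proposition3p8 1 (s≤s ())
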